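{- Let $n\geq 2$ and let $G_n^{P}$ be the flip graph of permutations of $[n]$ (defined in the context). Then: (i) if $\lfloor n/2\rfloor$ is odd, then $G_n^{P}$ has no rainbow cycle; (ii) if $\lfloor n/2\rfloor$ is even, then $G_n^{P}$ has a rainbow cycle.
   Context: $G_n^{P}$ is the undirected graph whose vertices are the permutations $\pi=(\pi(1),\dots,\pi(n))$ of $[n]=\{1,\dots,n\}$, with an edge between two permutations that differ by exchanging the entries at two positions $i\neq j$; this edge is labeled with the pair $\{i,j\}$. A rainbow cycle (1-rainbow cycle) in $G_n^{P}$ is a cycle (no repeated vertices) along which each of the $\binom{n}{2}$ pairs $\{i,j\}\subseteq[n]$ appears exactly once as an edge label. -}

module Defs where

open import Data.Nat using (ℕ; zero; suc; _≤_)
open import Data.Nat.DivMod using (_mod_)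
open import Data.Fin using (Fin; toℕ; _<_)
open import Data.Vec using (Vec; lookup; _[_]≔_)
open import Data.Product using (Σ; ∃; ∃!; _×_; _,_; proj₁; proj₂)
open import Relation.Binary.PropositionalEquality using (_≡_)
open import Function.Definitions using (Injective)

-- A permutation π of [n] (positions and values indexed by Fin n) is stored as
-- the vector (π(1),…,π(n)); it must have pairwise distinct entries.
IsPerm : ∀ {n} → Vec (Fin n) n → Set
IsPerm {n} v = ∀ (i j : Fin n) → lookup v i ≡ lookup v j → i ≡ j

swap : ∀ {n} → Vec (Fin n) n → Fin n → Fin n → Vec (Fin n) n
swap v i j = (v [ i ]≔ lookup v j) [ j ]≔ lookup v i

next : ∀ {m} → Fin (suc m) → Fin (suc m)
next {m} k = suc (toℕ k) mod (suc m)

-- An edge label {i,j} is stored canonically as the ordered pair (i , j) with i < j.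
record RainbowCycle (n : ℕ) : Set where
  field
    len      : ℕ
    len≥3    : 3 ≤ suc len
    vertex   : Fin (suc len) → Vec (Fin n) n
    isPerm   : ∀ k → IsPerm (vertex k)
    distinct : Injective _≡_ _≡_ vertex
    label    : Fin (suc len) → Fin n × Fin n
    ordered  : ∀ k → proj₁ (label k) < proj₂ (label k)
    step     : ∀ k → vertex (next k) ≡ swap (vertex k) (proj₁ (label k)) (proj₂ (label k))
    rainbow  : ∀ (i j : Fin n) → i < j → ∃! _≡_ (λ k → label k ≡ (i , j))

-- (i) A flip is a transposition, so it changes the parity of the number of inversions and every
-- cycle in the flip graph has even length. A rainbow cycle has exactly C(n,2) edges, and C(n,2)
-- is odd precisely when ⌊n/2⌋ is odd.
--
-- (ii) Induction on n in steps of four, from the cycles for n = 4 and n = 5 found by computation.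
-- Take a rainbow cycle on n positions through the identity whose first flip is {2,3}, and move it
-- to positions 4, …, n + 3 of [n + 4]. Its first flip becomes {6,7}; replace it by a detour from
-- the identity that uses every label meeting the new positions 0–3 once: flip {2,3}, sweep the
-- old positions upwards flipping each with 0 and then 1, flip {0,1}, {1,3}, {0,2}, sweep back
-- down flipping with 2 and then 3, and finish with {6,7}, {0,3}, {1,2}. This reaches the moved
-- copy of the old cycle's second vertex. The vertices of the detour are distinct because each
-- one's position along it can be read off from its entries at positions 0, 1, 2, 3 and 6.

module Submission where

open import Defs
open import Data.Bool using (Bool; true; false; not; _xor_; if_then_else_)
open import Data.Bool.Properties using (not-distribʳ-xor; not-distribˡ-xor; not-involutive; xor-assoc; xor-same; xor-identityʳ) renaming (_≟_ to _≟ᵇ_)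
open import Data.Nat as ℕ using (ℕ; zero; suc; _+_; _∸_; z≤n; s≤s; z<s; _≤_; _<_; _<ᵇ_; _≡ᵇ_)
import Data.Nat.Properties as ℕ
open import Data.Nat.DivMod using (_/_; _%_; m<n⇒m%n≡m; n%n≡0; m/n≡1+[m∸n]/n; [m+n]%n≡m%n)
open import Data.Fin as F using (Fin; toℕ; fromℕ<; _↑ʳ_) renaming (zero to fz; suc to fs)
open import Data.Fin.Patterns using (0F; 1F; 2F; 3F; 4F; 6F; 7F)
import Data.Fin.Properties as F
open import Data.Fin.Permutation.Components using (transpose; transpose-inverse)
open import Data.Vec as V using (Vec; lookup; _[_]≔_; tabulate; _∷_; [])
import Data.Vec.Properties as V
open import Data.List as L using (List; _++_; map; length; []; _∷_; take; allFin; foldl)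
import Data.List.Properties as L
open import Data.List.Relation.Unary.Unique.Propositional using (Unique)
import Data.List.Relation.Unary.Unique.Propositional.Properties as Unique
import Data.List.Relation.Unary.Unique.DecPropositional as UniqueDec
import Data.List.Membership.DecPropositional as Membership
open import Data.List.Relation.Unary.All as All using (All)
import Data.List.Relation.Unary.All.Properties as All
open import Data.List.Relation.Unary.AllPairs as AllPairs using ()
open import Data.List.Relation.Unary.Any as Any using (here; there)
open import Data.List.Relation.Unary.Any.Properties using (lookup-index)
open import Data.List.Membership.Propositional using (_∈_)
open import Data.List.Membership.Propositional.Properties using (∈-map⁺; ∈-map⁻; ∈-++⁺ˡ; ∈-++⁺ʳ; ∈-allFin; ∈-lookup)
open import Data.Product using (_×_; _,_; proj₁; proj₂)
open import Data.Product.Properties using () renaming (≡-dec to ×-≡-dec)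
open import Data.Sum using (_⊎_; inj₁; inj₂)
open import Relation.Binary.PropositionalEquality
open import Relation.Binary.Definitions using (tri<; tri≈; tri>)
open import Relation.Nullary using (¬_; Dec; yes; no)
open import Relation.Nullary.Decidable using (from-yes; _→-dec_)
open import Data.Empty using (⊥-elim)
open import Function using (_∘_; id)

-- Walks in the flip graph

Vertex : ℕ → Set
Vertex n = Vec (Fin n) n

Label : ℕ → Set
Label n = Fin n × Fin n

identity : ∀ n → Vertex n
identity n = tabulate id

flip : ∀ {n} → Vertex n → Label n → Vertex n
flip v (i , j) = swap v i j

walkEnd : ∀ {n} → Vertex n → List (Label n) → Vertex n
walkEnd = foldl flip

walk : ∀ {n} → Vertex n → List (Label n) → List (Vertex n)
walk v []       = []
walk v (l ∷ ls) = v ∷ walk (flip v l) ls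

walk-++ : ∀ {n} (v : Vertex n) xs ys → walk v (xs ++ ys) ≡ walk v xs ++ walk (walkEnd v xs) ys
walk-++ v []       ys = refl
walk-++ v (x ∷ xs) ys = cong (v ∷_) (walk-++ (flip v x) xs ys)

Vec-ext : ∀ {A : Set} {n} {v w : Vec A n} → (∀ p → lookup v p ≡ lookup w p) → v ≡ w
Vec-ext {v = v} {w} v≗w = trans (sym (V.tabulate∘lookup v)) (trans (V.tabulate-cong v≗w) (V.tabulate∘lookup w))

-- Defs.swap for vectors of any length; on a Vertex the two agree definitionally.
exchange : ∀ {A : Set} {k} → Vec A k → Fin k → Fin k → Vec A k
exchange v i j = (v [ i ]≔ lookup v j) [ j ]≔ lookup v i

module _ {A : Set} {k} (v : Vec A k) (i j : Fin k) where

  lookup-exchange-second : lookup (exchange v i j) j ≡ lookup v i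
  lookup-exchange-second = V.lookup∘update j (v [ i ]≔ lookup v j) (lookup v i)

  lookup-exchange-first : lookup (exchange v i j) i ≡ lookup v j
  lookup-exchange-first with i F.≟ j
  ... | yes refl = lookup-exchange-second
  ... | no i≢j   = trans (V.lookup∘update′ i≢j (v [ i ]≔ lookup v j) (lookup v i))
                         (V.lookup∘update i v (lookup v j))

  lookup-exchange-other : ∀ p → p ≢ i → p ≢ j → lookup (exchange v i j) p ≡ lookup v p
  lookup-exchange-other p p≢i p≢j = trans (V.lookup∘update′ p≢j (v [ i ]≔ lookup v j) (lookup v i))
                                          (V.lookup∘update′ p≢i v (lookup v j))

  lookup-exchange : ∀ p → lookup (exchange v i j) p ≡ lookup v (transpose i j p)
  lookup-exchange p with p F.≟ i
  ... | yes refl = lookup-exchange-first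
  ... | no p≢i with p F.≟ j
  ...   | yes refl = lookup-exchange-second
  ...   | no p≢j   = lookup-exchange-other p p≢i p≢j

Distinct : ∀ {A : Set} {k} → Vec A k → Set
Distinct v = ∀ p q → lookup v p ≡ lookup v q → p ≡ q

exchange-distinct : ∀ {A : Set} {k} {v : Vec A k} i j → Distinct v → Distinct (exchange v i j)
exchange-distinct {v = v} i j v-distinct p q eq = begin
  p                                  ≡⟨ sym (transpose-inverse j i) ⟩
  transpose j i (transpose i j p)    ≡⟨ cong (transpose j i) (v-distinct _ _ lookups) ⟩
  transpose j i (transpose i j q)    ≡⟨ transpose-inverse j i ⟩
  q                                  ∎
  where
  open ≡-Reasoning
  lookups : lookup v (transpose i j p) ≡ lookup v (transpose i j q)
  lookups = trans (sym (lookup-exchange v i j p)) (trans eq (lookup-exchange v i j q))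

identity-isPerm : ∀ n → IsPerm (identity n)
identity-isPerm n p q eq = trans (sym (V.lookup∘tabulate id p)) (trans eq (V.lookup∘tabulate id q))

walkEnd-isPerm : ∀ {n} {v : Vertex n} ls → IsPerm v → IsPerm (walkEnd v ls)
walkEnd-isPerm []             v-perm = v-perm
walkEnd-isPerm {v = v} ((i , j) ∷ ls) v-perm = walkEnd-isPerm ls (exchange-distinct {v = v} i j v-perm)

-- Parity of the number of inversions

∀-Bool? : {P : Bool → Set} → (∀ b → Dec (P b)) → Dec (∀ b → P b)
∀-Bool? P? with P? false | P? true
... | yes f | yes t = yes λ { false → f ; true → t }
... | no ¬f | _     = no λ h → ¬f (h false)
... | yes _ | no ¬t = no λ h → ¬t (h true)

xor-cancelˡ : ∀ a b → a xor (a xor b) ≡ b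
xor-cancelˡ a b = trans (sym (xor-assoc a a b)) (cong (_xor b) (xor-same a))

<ᵇ-flip : ∀ a b → a ≢ b → (a <ᵇ b) ≡ not (b <ᵇ a)
<ᵇ-flip zero    zero    a≢b = ⊥-elim (a≢b refl)
<ᵇ-flip zero    (suc b) _   = refl
<ᵇ-flip (suc a) zero    _   = refl
<ᵇ-flip (suc a) (suc b) a≢b = <ᵇ-flip a b (a≢b ∘ cong suc)

module Inversions {n : ℕ} where

  _≺_ : Fin n → Fin n → Bool
  a ≺ b = toℕ a <ᵇ toℕ b

  ≺-flip : ∀ {a b} → a ≢ b → (a ≺ b) ≡ not (b ≺ a)
  ≺-flip {a} {b} a≢b = <ᵇ-flip (toℕ a) (toℕ b) (a≢b ∘ F.toℕ-injective)

  parityBelow : ∀ {k} → Fin n → Vec (Fin n) k → Bool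
  parityBelow x []       = false
  parityBelow x (y ∷ ys) = (y ≺ x) xor parityBelow x ys

  parity : ∀ {k} → Vec (Fin n) k → Bool
  parity []       = false
  parity (x ∷ xs) = parityBelow x xs xor parity xs

  parityBelow-update : ∀ {k} x (ys : Vec (Fin n) k) j z →
                 parityBelow x (ys [ j ]≔ z) ≡ parityBelow x ys xor ((lookup ys j ≺ x) xor (z ≺ x))
  parityBelow-update x (y ∷ ys) fz     z = xor-law (y ≺ x) (z ≺ x) (parityBelow x ys)
    where
    xor-law : ∀ a b c → b xor c ≡ (a xor c) xor (a xor b)
    xor-law = from-yes (∀-Bool? λ a → ∀-Bool? λ b → ∀-Bool? λ c → b xor c ≟ᵇ (a xor c) xor (a xor b))
  parityBelow-update x (y ∷ ys) (fs j) z =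
    trans (cong ((y ≺ x) xor_) (parityBelow-update x ys j z)) (sym (xor-assoc (y ≺ x) (parityBelow x ys) _))

  parityBelow-exchange-head : ∀ {k} x y (ys : Vec (Fin n) k) j → parityBelow x (lookup ys j ∷ (ys [ j ]≔ y)) ≡ parityBelow x (y ∷ ys)
  parityBelow-exchange-head x y ys j =
    trans (cong ((lookup ys j ≺ x) xor_) (parityBelow-update x ys j y)) (xor-law (lookup ys j ≺ x) (parityBelow x ys) (y ≺ x))
    where
    xor-law : ∀ a b c → a xor (b xor (a xor c)) ≡ c xor b
    xor-law = from-yes (∀-Bool? λ a → ∀-Bool? λ b → ∀-Bool? λ c → a xor (b xor (a xor c)) ≟ᵇ c xor b)

  parityBelow-exchange : ∀ {k} x (ys : Vec (Fin n) k) i j → parityBelow x (exchange ys i j) ≡ parityBelow x ys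
  parityBelow-exchange x (y ∷ ys) fz     fz     = refl
  parityBelow-exchange x (y ∷ ys) fz     (fs j) = parityBelow-exchange-head x y ys j
  parityBelow-exchange x (y ∷ ys) (fs i) fz     = parityBelow-exchange-head x y ys i
  parityBelow-exchange x (y ∷ ys) (fs i) (fs j) = cong ((y ≺ x) xor_) (parityBelow-exchange x ys i j)

  distinct-tail : ∀ {k} {x} {xs : Vec (Fin n) k} → Distinct (x ∷ xs) → Distinct xs
  distinct-tail d p q eq = F.suc-injective (d (fs p) (fs q) eq)

  parity-exchange-head : ∀ {k} (xs : Vec (Fin n) k) j x → (∀ p → x ≢ lookup xs p) → Distinct xs →
                         parity (lookup xs j ∷ (xs [ j ]≔ x)) ≡ not (parity (x ∷ xs))
  parity-exchange-head (w ∷ ws) fz x x∉ d = begin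
      ((x ≺ w) xor parityBelow w ws) xor (parityBelow x ws xor parity ws)
    ≡⟨ cong (λ c → (c xor parityBelow w ws) xor (parityBelow x ws xor parity ws)) (≺-flip (x∉ fz)) ⟩
      (not (w ≺ x) xor parityBelow w ws) xor (parityBelow x ws xor parity ws)
    ≡⟨ xor-law (w ≺ x) (parityBelow w ws) (parityBelow x ws) (parity ws) ⟩
      not (((w ≺ x) xor parityBelow x ws) xor (parityBelow w ws xor parity ws))
    ∎
    where
    open ≡-Reasoning
    xor-law : ∀ a p q r → (not a xor p) xor (q xor r) ≡ not ((a xor q) xor (p xor r))
    xor-law = from-yes (∀-Bool? λ a → ∀-Bool? λ p → ∀-Bool? λ q → ∀-Bool? λ r →
                (not a xor p) xor (q xor r) ≟ᵇ not ((a xor q) xor (p xor r)))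
  parity-exchange-head (w ∷ ws) (fs k) x x∉ d = begin
      ((w ≺ y) xor A) xor (parityBelow w ws′ xor parity ws′)
    ≡⟨ cong₂ (λ c e → (c xor A) xor e) (≺-flip w≢y) (cong₂ _xor_ (parityBelow-update w ws k x) induction) ⟩
      (not (y ≺ w) xor A) xor ((parityBelow w ws xor ((y ≺ w) xor (x ≺ w))) xor (A xor not (parityBelow x ws xor parity ws)))
    ≡⟨ xor-law (y ≺ w) (x ≺ w) A (parityBelow w ws) (parityBelow x ws) (parity ws) ⟩
      not ((not (x ≺ w) xor parityBelow x ws) xor (parityBelow w ws xor parity ws))
    ≡⟨ cong (λ c → not ((c xor parityBelow x ws) xor (parityBelow w ws xor parity ws))) (sym (≺-flip (x∉ fz ∘ sym))) ⟩
      not (((w ≺ x) xor parityBelow x ws) xor (parityBelow w ws xor parity ws))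
    ∎
    where
    open ≡-Reasoning
    y : Fin n
    y = lookup ws k
    ws′ : Vec (Fin n) _
    ws′ = ws [ k ]≔ x
    A : Bool
    A = parityBelow y ws′
    w≢y : w ≢ y
    w≢y = F.0≢1+n ∘ d fz (fs k)
    induction : parity ws′ ≡ A xor not (parityBelow x ws xor parity ws)
    induction = trans (sym (xor-cancelˡ A (parity ws′)))
                      (cong (A xor_) (parity-exchange-head ws k x (x∉ ∘ fs) (distinct-tail d)))
    xor-law : ∀ a b A P Q R →
              (not a xor A) xor ((P xor (a xor b)) xor (A xor not (Q xor R))) ≡ not ((not b xor Q) xor (P xor R))
    xor-law = from-yes (∀-Bool? λ a → ∀-Bool? λ b → ∀-Bool? λ A → ∀-Bool? λ P → ∀-Bool? λ Q → ∀-Bool? λ R →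
                (not a xor A) xor ((P xor (a xor b)) xor (A xor not (Q xor R))) ≟ᵇ not ((not b xor Q) xor (P xor R)))

  parity-exchange : ∀ {k} (v : Vec (Fin n) k) i j → i ≢ j → Distinct v → parity (exchange v i j) ≡ not (parity v)
  parity-exchange (x ∷ xs) fz     fz     i≢j d = ⊥-elim (i≢j refl)
  parity-exchange (x ∷ xs) fz     (fs j) i≢j d =
    parity-exchange-head xs j x (λ p → F.0≢1+n ∘ d fz (fs p)) (distinct-tail d)
  parity-exchange (x ∷ xs) (fs i) fz     i≢j d =
    parity-exchange-head xs i x (λ p → F.0≢1+n ∘ d fz (fs p)) (distinct-tail d)
  parity-exchange (x ∷ xs) (fs i) (fs j) i≢j d =
    trans (cong₂ _xor_ (parityBelow-exchange x xs i j) (parity-exchange xs i j (i≢j ∘ cong fs) (distinct-tail d)))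
          (sym (not-distribʳ-xor (parityBelow x xs) (parity xs)))

-- The length of a rainbow cycle

choose2 : ℕ → ℕ
choose2 zero    = 0
choose2 (suc n) = choose2 n + n

liftPair : ∀ {n} → Label n → Label (suc n)
liftPair (i , j) = fs i , fs j

liftPair-injective : ∀ {n} {x y : Label n} → liftPair x ≡ liftPair y → x ≡ y
liftPair-injective {x = _ , _} {_ , _} eq = cong₂ _,_ (F.suc-injective (cong proj₁ eq)) (F.suc-injective (cong proj₂ eq))

pairs : ∀ n → List (Label n)
pairs zero    = []
pairs (suc n) = map (λ j → fz , fs j) (allFin n) ++ map liftPair (pairs n)

length-pairs : ∀ n → length (pairs n) ≡ choose2 n
length-pairs zero    = refl
length-pairs (suc n) = begin
  length (map (λ j → fz , fs j) (allFin n) ++ map liftPair (pairs n))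
    ≡⟨ L.length-++ (map (λ j → fz , fs j) (allFin n)) ⟩
  length (map (λ j → fz , fs j) (allFin n)) + length (map liftPair (pairs n))
    ≡⟨ cong₂ _+_ (trans (L.length-map _ (allFin n)) (L.length-tabulate id))
                 (trans (L.length-map liftPair (pairs n)) (length-pairs n)) ⟩
  n + choose2 n
    ≡⟨ ℕ.+-comm n (choose2 n) ⟩
  choose2 n + n ∎
  where open ≡-Reasoning

pairs-unique : ∀ n → Unique (pairs n)
pairs-unique zero    = AllPairs.[]
pairs-unique (suc n) =
  Unique.++⁺ (Unique.map⁺ (F.suc-injective ∘ cong proj₂) (Unique.allFin⁺ n))
             (Unique.map⁺ liftPair-injective (pairs-unique n))
             head≢lifted
  where
  head≢lifted : ∀ {l} → ¬ (l ∈ map (λ j → fz , fs j) (allFin n) × l ∈ map liftPair (pairs n))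
  head≢lifted (p , q) with ∈-map⁻ (λ j → fz , fs j) p | ∈-map⁻ liftPair q
  ... | _ , _ , refl | _ , _ , ()

∈-pairs : ∀ {n} (i j : Fin n) → i F.< j → (i , j) ∈ pairs n
∈-pairs {suc n} fz     (fs j) _         = ∈-++⁺ˡ (∈-map⁺ (λ j → fz , fs j) (∈-allFin j))
∈-pairs {suc n} (fs i) (fs j) (s≤s i<j) = ∈-++⁺ʳ (map (λ j → fz , fs j) (allFin n)) (∈-map⁺ liftPair (∈-pairs i j i<j))

pairs-ordered : ∀ n → All (λ l → proj₁ l F.< proj₂ l) (pairs n)
pairs-ordered zero    = All.[]
pairs-ordered (suc n) = All.++⁺ (All.map⁺ (All.tabulate (λ _ → s≤s z≤n))) (All.map⁺ (All.map s≤s (pairs-ordered n)))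

Unique-lookup-injective : ∀ {A : Set} {xs : List A} → Unique xs → ∀ a b → L.lookup xs a ≡ L.lookup xs b → a ≡ b
Unique-lookup-injective (_    AllPairs.∷ _) fz     fz     _  = refl
Unique-lookup-injective (x∉xs AllPairs.∷ _) fz     (fs b) eq = ⊥-elim (All.lookup x∉xs (∈-lookup b) eq)
Unique-lookup-injective (x∉xs AllPairs.∷ _) (fs a) fz     eq = ⊥-elim (All.lookup x∉xs (∈-lookup a) (sym eq))
Unique-lookup-injective (_    AllPairs.∷ u) (fs a) (fs b) eq = cong fs (Unique-lookup-injective u a b eq)

toℕ-next : ∀ {m} (k : Fin (suc m)) → toℕ (next k) ≡ suc (toℕ k) % suc m
toℕ-next k = F.toℕ-fromℕ< _

odd : ℕ → Bool
odd zero    = false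
odd (suc n) = not (odd n)

module _ {n : ℕ} (R : RainbowCycle n) where
  open RainbowCycle R
  open Inversions

  label-injective : ∀ {k k′} → label k ≡ label k′ → k ≡ k′
  label-injective {k} eq with rainbow (proj₁ (label k)) (proj₂ (label k)) (ordered k)
  ... | _ , _ , unique = trans (sym (unique refl)) (unique (sym eq))

  -- The labels give injections in both directions between the edges of R and pairs n.
  rainbowCycle-length : suc len ≡ choose2 n
  rainbowCycle-length = trans (ℕ.≤-antisym (F.injective⇒≤ index-injective) (F.injective⇒≤ edge-injective)) (length-pairs n)
    where
    index : Fin (suc len) → Fin (length (pairs n))
    index k = Any.index (∈-pairs _ _ (ordered k))
    index-injective : ∀ {k k′} → index k ≡ index k′ → k ≡ k′
    index-injective {k} {k′} eq = label-injective (begin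
      label k                                  ≡⟨ lookup-index (∈-pairs _ _ (ordered k)) ⟩
      L.lookup (pairs n) (index k)             ≡⟨ cong (L.lookup (pairs n)) eq ⟩
      L.lookup (pairs n) (index k′)            ≡⟨ sym (lookup-index (∈-pairs _ _ (ordered k′))) ⟩
      label k′                                 ∎)
      where open ≡-Reasoning
    edge : Fin (length (pairs n)) → Fin (suc len)
    edge a = proj₁ (rainbow _ _ (All.lookup (pairs-ordered n) (∈-lookup a)))
    label-edge : ∀ a → label (edge a) ≡ L.lookup (pairs n) a
    label-edge a = proj₁ (proj₂ (rainbow _ _ (All.lookup (pairs-ordered n) (∈-lookup a))))
    edge-injective : ∀ {a b} → edge a ≡ edge b → a ≡ b
    edge-injective {a} {b} eq =
      Unique-lookup-injective (pairs-unique n) a b (trans (sym (label-edge a)) (trans (cong label eq) (label-edge b)))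

  vertexParity : Fin (suc len) → Bool
  vertexParity k = parity (vertex k)

  vertexParity-next : ∀ k → vertexParity (next k) ≡ not (vertexParity k)
  vertexParity-next k rewrite step k =
    parity-exchange (vertex k) _ _ (λ eq → ℕ.<-irrefl (cong toℕ eq) (ordered k)) (isPerm k)

  vertexParity-fromℕ< : ∀ t (t<len : t < suc len) → vertexParity (fromℕ< t<len) ≡ vertexParity fz xor odd t
  vertexParity-fromℕ< zero    _     = sym (xor-identityʳ (vertexParity fz))
  vertexParity-fromℕ< (suc t) t<len = begin
    vertexParity (fromℕ< t<len)         ≡⟨ cong vertexParity (sym next-t) ⟩
    vertexParity (next (fromℕ< t′<len)) ≡⟨ vertexParity-next (fromℕ< t′<len) ⟩
    not (vertexParity (fromℕ< t′<len))  ≡⟨ cong not (vertexParity-fromℕ< t t′<len) ⟩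
    not (vertexParity fz xor odd t)     ≡⟨ not-distribʳ-xor (vertexParity fz) (odd t) ⟩
    vertexParity fz xor odd (suc t)     ∎
    where
    open ≡-Reasoning
    t′<len : t < suc len
    t′<len = ℕ.<-trans (ℕ.n<1+n t) t<len
    next-t : next (fromℕ< t′<len) ≡ fromℕ< t<len
    next-t = F.toℕ-injective (begin
      toℕ (next (fromℕ< t′<len))          ≡⟨ toℕ-next (fromℕ< t′<len) ⟩
      suc (toℕ (fromℕ< t′<len)) % suc len ≡⟨ cong (λ z → suc z % suc len) (F.toℕ-fromℕ< t′<len) ⟩
      suc t % suc len                     ≡⟨ m<n⇒m%n≡m t<len ⟩
      suc t                               ≡⟨ sym (F.toℕ-fromℕ< t<len) ⟩
      toℕ (fromℕ< t<len)                  ∎)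

  -- Going once around the cycle flips the parity suc len times and returns to vertex fz.
  rainbowCycle-even : odd (suc len) ≡ false
  rainbowCycle-even = begin
    odd (suc len)                    ≡⟨ sym (xor-cancelˡ p (odd (suc len))) ⟩
    p xor (p xor odd (suc len))      ≡⟨ cong (p xor_) (sym around) ⟩
    p xor p                          ≡⟨ xor-same p ⟩
    false                            ∎
    where
    open ≡-Reasoning
    p : Bool
    p = vertexParity fz
    last : Fin (suc len)
    last = fromℕ< (ℕ.n<1+n len)
    next-last : next last ≡ fz
    next-last = F.toℕ-injective (trans (toℕ-next last)
                  (trans (cong (λ z → suc z % suc len) (F.toℕ-fromℕ< (ℕ.n<1+n len))) (n%n≡0 (suc len))))
    around : p ≡ p xor odd (suc len)
    around = begin
      p                           ≡⟨ cong vertexParity (sym next-last) ⟩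
      vertexParity (next last)    ≡⟨ vertexParity-next last ⟩
      not (vertexParity last)     ≡⟨ cong not (vertexParity-fromℕ< len (ℕ.n<1+n len)) ⟩
      not (p xor odd len)         ≡⟨ not-distribʳ-xor p (odd len) ⟩
      p xor odd (suc len)         ∎

odd-+ : ∀ a b → odd (a + b) ≡ odd a xor odd b
odd-+ zero    b = refl
odd-+ (suc a) b = trans (cong not (odd-+ a b)) (not-distribˡ-xor (odd a) (odd b))

/2-suc-suc : ∀ k → suc (suc k) / 2 ≡ suc (k / 2)
/2-suc-suc k = m/n≡1+[m∸n]/n {suc (suc k)} {2} (s≤s (s≤s z≤n))

%2-suc-suc : ∀ k → suc (suc k) % 2 ≡ k % 2
%2-suc-suc k = trans (cong (_% 2) (ℕ.+-comm 2 k)) ([m+n]%n≡m%n k 2)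

odd-choose2 : ∀ n → odd (choose2 n) ≡ odd (n / 2)
odd-choose2 zero          = refl
odd-choose2 (suc zero)    = refl
odd-choose2 (suc (suc k)) = begin
  odd ((choose2 k + k) + suc k)           ≡⟨ trans (odd-+ (choose2 k + k) (suc k)) (cong (_xor odd (suc k)) (odd-+ (choose2 k) k)) ⟩
  (odd (choose2 k) xor odd k) xor not (odd k) ≡⟨ xor-law (odd (choose2 k)) (odd k) ⟩
  not (odd (choose2 k))                   ≡⟨ cong not (odd-choose2 k) ⟩
  not (odd (k / 2))                       ≡⟨ cong odd (sym (/2-suc-suc k)) ⟩
  odd (suc (suc k) / 2)                   ∎
  where
  open ≡-Reasoning
  xor-law : ∀ a b → (a xor b) xor not b ≡ not a
  xor-law = from-yes (∀-Bool? λ a → ∀-Bool? λ b → (a xor b) xor not b ≟ᵇ not a)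

odd-%2 : ∀ x → x % 2 ≡ 1 → odd x ≡ true
odd-%2 (suc zero)    _ = refl
odd-%2 (suc (suc x)) h = trans (not-involutive (odd x)) (odd-%2 x (trans (sym (%2-suc-suc x)) h))

noRainbowCycle : ∀ n → (n / 2) % 2 ≡ 1 → ¬ RainbowCycle n
noRainbowCycle n ⌊n/2⌋-odd R = true≢false (begin
  true                               ≡⟨ sym (odd-%2 (n / 2) ⌊n/2⌋-odd) ⟩
  odd (n / 2)                        ≡⟨ sym (odd-choose2 n) ⟩
  odd (choose2 n)                    ≡⟨ cong odd (sym (rainbowCycle-length R)) ⟩
  odd (suc (RainbowCycle.len R))     ≡⟨ rainbowCycle-even R ⟩
  false                              ∎)
  where
  open ≡-Reasoning
  true≢false : true ≢ false
  true≢false ()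

-- Vertices described by their entries

Realises : ∀ {n} → Vertex n → (ℕ → ℕ) → Set
Realises v f = ∀ p → toℕ (lookup v p) ≡ f (toℕ p)

realises-cong : ∀ {n} {v : Vertex n} {f g} → Realises v f → (∀ x → f x ≡ g x) → Realises v g
realises-cong v⊨f f≗g p = trans (v⊨f p) (f≗g _)

realises-unique : ∀ {n} {v w : Vertex n} {f} → Realises v f → Realises w f → v ≡ w
realises-unique v⊨f w⊨f = Vec-ext λ p → F.toℕ-injective (trans (v⊨f p) (sym (w⊨f p)))

realises-identity : ∀ n → Realises (identity n) id
realises-identity n p = cong toℕ (V.lookup∘tabulate id p)

record Exchanged (f : ℕ → ℕ) (a b : ℕ) (g : ℕ → ℕ) : Set where
  constructor exchanged
  field
    at-first  : g a ≡ f b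
    at-second : g b ≡ f a
    elsewhere : ∀ x → x ≢ a → x ≢ b → g x ≡ f x

realises-swap : ∀ {n} {v : Vertex n} {f g a b} (i j : Fin n) → toℕ i ≡ a → toℕ j ≡ b → Realises v f →
                Exchanged f a b g → Realises (swap v i j) g
realises-swap {v = v} i j refl refl v⊨f (exchanged g-i g-j g-other) p with p F.≟ j
... | yes refl = trans (cong toℕ (lookup-exchange-second v i p)) (trans (v⊨f i) (sym g-j))
... | no p≢j with p F.≟ i
...   | yes refl = trans (cong toℕ (lookup-exchange-first v p j)) (trans (v⊨f j) (sym g-i))
...   | no p≢i   = trans (cong toℕ (lookup-exchange-other v i j p p≢i p≢j))
                         (trans (v⊨f p) (sym (g-other (toℕ p) (p≢i ∘ F.toℕ-injective) (p≢j ∘ F.toℕ-injective))))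

Numbered : ∀ {A : Set} → (A → ℕ) → ℕ → List A → Set
Numbered code c xs = map code xs ≡ L.iterate suc c (length xs)

iterate-suc-++ : ∀ c a b → L.iterate suc c (a + b) ≡ L.iterate suc c a ++ L.iterate suc (c + a) b
iterate-suc-++ c zero    b = cong (λ z → L.iterate suc z b) (sym (ℕ.+-identityʳ c))
iterate-suc-++ c (suc a) b = cong (c ∷_) (trans (iterate-suc-++ (suc c) a b)
                                                (cong (λ z → L.iterate suc (suc c) a ++ L.iterate suc z b) (sym (ℕ.+-suc c a))))

∈-iterate-suc⇒≥ : ∀ {c l x} → x ∈ L.iterate suc c l → c ≤ x
∈-iterate-suc⇒≥ {l = suc l} (here refl) = ℕ.≤-refl
∈-iterate-suc⇒≥ {l = suc l} (there x∈) = ℕ.<⇒≤ (∈-iterate-suc⇒≥ x∈)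

iterate-suc-unique : ∀ c l → Unique (L.iterate suc c l)
iterate-suc-unique c zero    = AllPairs.[]
iterate-suc-unique c (suc l) = All.tabulate (λ x∈ → ℕ.<⇒≢ (∈-iterate-suc⇒≥ x∈)) AllPairs.∷ iterate-suc-unique (suc c) l

module _ {A : Set} {code : A → ℕ} where

  numbered-++ : ∀ {c} xs ys → Numbered code c xs → Numbered code (c + length xs) ys → Numbered code c (xs ++ ys)
  numbered-++ {c} xs ys xs# ys# = begin
    map code (xs ++ ys)                                           ≡⟨ L.map-++ code xs ys ⟩
    map code xs ++ map code ys                                    ≡⟨ cong₂ _++_ xs# ys# ⟩
    L.iterate suc c (length xs) ++ L.iterate suc (c + length xs) (length ys) ≡⟨ sym (iterate-suc-++ c (length xs) (length ys)) ⟩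
    L.iterate suc c (length xs + length ys)                       ≡⟨ cong (L.iterate suc c) (sym (L.length-++ xs)) ⟩
    L.iterate suc c (length (xs ++ ys))                           ∎
    where open ≡-Reasoning

  numbered-unique : ∀ {c xs} → Numbered code c xs → Unique xs
  numbered-unique {c} {xs} xs# = Unique.map⁻ (subst Unique (sym xs#) (iterate-suc-unique c (length xs)))

length-walk : ∀ {n} (v : Vertex n) ls → length (walk v ls) ≡ length ls
length-walk v []       = refl
length-walk v (l ∷ ls) = cong suc (length-walk (flip v l) ls)

module CodedWalks {N : ℕ} (code : Vertex N → ℕ) where

  record CodedWalk (c : ℕ) (f : ℕ → ℕ) (ls : List (Label N)) (g : ℕ → ℕ) : Set where
    constructor codedWalk
    field run : ∀ v → Realises v f → Numbered code c (walk v ls) × Realises (walkEnd v ls) g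

  open CodedWalk public

  coded-[] : ∀ {c f g} → (∀ x → f x ≡ g x) → CodedWalk c f [] g
  coded-[] f≗g = codedWalk λ v v⊨f → refl , realises-cong {v = v} v⊨f f≗g

  coded-∷ : ∀ {c f h g ls a b} (i j : Fin N) → toℕ i ≡ a → toℕ j ≡ b → (∀ v → Realises v f → code v ≡ c) →
            Exchanged f a b h → CodedWalk (suc c) h ls g → CodedWalk c f ((i , j) ∷ ls) g
  coded-∷ i j i≡a j≡b code-f f⇄h rest = codedWalk λ v v⊨f →
    let (walk# , end⊨g) = run rest (swap v i j) (realises-swap {v = v} i j i≡a j≡b v⊨f f⇄h)
    in cong₂ _∷_ (code-f v v⊨f) walk# , end⊨g

  coded-++ : ∀ {c f g h} xs ys → CodedWalk c f xs g → CodedWalk (c + length xs) g ys h → CodedWalk c f (xs ++ ys) h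
  coded-++ {c} {h = h} xs ys xs-walk ys-walk = codedWalk λ v v⊨f →
    let (xs# , mid⊨g) = run xs-walk v v⊨f
        (ys# , end⊨h) = run ys-walk (walkEnd v xs) mid⊨g
    in subst (Numbered code c) (sym (walk-++ v xs ys))
         (numbered-++ (walk v xs) (walk (walkEnd v xs) ys) xs#
           (subst (λ l → Numbered code (c + l) (walk (walkEnd v xs) ys)) (sym (length-walk v xs)) ys#))
     , subst (λ w → Realises w h) (sym (L.foldl-++ flip v xs ys)) end⊨h

  coded-cast : ∀ {c c′ f g ls} → c ≡ c′ → CodedWalk c f ls g → CodedWalk c′ f ls g
  coded-cast refl w = w

-- Rainbow tours

Ordered : ∀ {n} → Label n → Set
Ordered (i , j) = i F.< j

first : ∀ {m} → Label (4 + m)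
first = 2F , 3F

-- A rainbow cycle on 4 + m positions through the identity, listed by its labels from the
-- identity on, whose first edge exchanges positions 2 and 3.
record RainbowTour (m : ℕ) : Set where
  field
    rest          : List (Label (4 + m))
    ordered       : All Ordered (first ∷ rest)
    labels-unique : Unique (first ∷ rest)
    covers        : ∀ i j → i F.< j → (i , j) ∈ first ∷ rest
    closed        : walkEnd (identity _) (first ∷ rest) ≡ identity _
    walk-unique   : Unique (walk (identity _) (first ∷ rest))
    long          : 2 ≤ length rest

take-suc-walkEnd : ∀ {n} (v : Vertex n) ls (k : Fin (length ls)) →
                   walkEnd v (take (suc (toℕ k)) ls) ≡ flip (walkEnd v (take (toℕ k) ls)) (L.lookup ls k)
take-suc-walkEnd v ls k = trans (cong (walkEnd v) (L.take-suc ls k)) (L.foldl-∷ʳ flip v (L.lookup ls k) (take (toℕ k) ls))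

walkEnd-take∈walk : ∀ {n} (v : Vertex n) ls t → t < length ls → walkEnd v (take t ls) ∈ walk v ls
walkEnd-take∈walk v (l ∷ ls) zero    _         = here refl
walkEnd-take∈walk v (l ∷ ls) (suc t) (s≤s t<) = there (walkEnd-take∈walk (flip v l) ls t t<)

walkEnd-take-injective : ∀ {n} (v : Vertex n) ls → Unique (walk v ls) → ∀ a b → a < length ls → b < length ls →
                         walkEnd v (take a ls) ≡ walkEnd v (take b ls) → a ≡ b
walkEnd-take-injective v (l ∷ ls) _              zero    zero    _        _        _  = refl
walkEnd-take-injective v (l ∷ ls) (v∉ AllPairs.∷ _) zero (suc b) _        (s≤s b<) eq =
  ⊥-elim (All.lookup v∉ (walkEnd-take∈walk (flip v l) ls b b<) eq)
walkEnd-take-injective v (l ∷ ls) (v∉ AllPairs.∷ _) (suc a) zero (s≤s a<) _        eq =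
  ⊥-elim (All.lookup v∉ (walkEnd-take∈walk (flip v l) ls a a<) (sym eq))
walkEnd-take-injective v (l ∷ ls) (_ AllPairs.∷ u)  (suc a) (suc b) (s≤s a<) (s≤s b<) eq =
  cong suc (walkEnd-take-injective (flip v l) ls u a b a< b< eq)

tour→cycle : ∀ {m} → RainbowTour m → RainbowCycle (4 + m)
tour→cycle {m} T = record
  { len      = length rest
  ; len≥3    = s≤s long
  ; vertex   = vertex
  ; isPerm   = λ k → walkEnd-isPerm (take (toℕ k) labels) (identity-isPerm _)
  ; distinct = λ {k} {k′} eq → F.toℕ-injective
                 (walkEnd-take-injective (identity _) labels walk-unique (toℕ k) (toℕ k′) (F.toℕ<n k) (F.toℕ<n k′) eq)
  ; label    = L.lookup labels
  ; ordered  = λ k → All.lookup ordered (∈-lookup k)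
  ; step     = step
  ; rainbow  = λ i j i<j → let ij∈ = covers i j i<j in
      Any.index ij∈ , sym (lookup-index ij∈) ,
      λ {k} eq → Unique-lookup-injective labels-unique (Any.index ij∈) k (trans (sym (lookup-index ij∈)) (sym eq))
  }
  where
  open RainbowTour T
  labels = first ∷ rest
  vertex : Fin (suc (length rest)) → Vertex (4 + m)
  vertex k = walkEnd (identity _) (take (toℕ k) labels)
  step : ∀ k → vertex (next k) ≡ flip (vertex k) (L.lookup labels k)
  step k with ℕ.<-cmp (toℕ k) (length rest)
  ... | tri< k<len _ _ = trans (cong (λ t → walkEnd (identity _) (take t labels)) (trans (toℕ-next k) (m<n⇒m%n≡m (s≤s k<len))))
                               (take-suc-walkEnd (identity _) labels k)
  ... | tri≈ _ k≡len _ = begin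
      walkEnd (identity _) (take (toℕ (next k)) labels)   ≡⟨ cong (λ t → walkEnd (identity _) (take t labels)) next-k≡0 ⟩
      identity _                                          ≡⟨ sym closed ⟩
      walkEnd (identity _) labels                         ≡⟨ cong (walkEnd (identity _)) (sym (L.take-all (suc (toℕ k)) labels (s≤s (ℕ.≤-reflexive (sym k≡len))))) ⟩
      walkEnd (identity _) (take (suc (toℕ k)) labels)    ≡⟨ take-suc-walkEnd (identity _) labels k ⟩
      flip (vertex k) (L.lookup labels k)                 ∎
    where
    open ≡-Reasoning
    next-k≡0 : toℕ (next k) ≡ 0
    next-k≡0 = trans (toℕ-next k) (trans (cong (λ z → suc z % suc (length rest)) k≡len) (n%n≡0 (suc (length rest))))
  ... | tri> _ _ k>len = ⊥-elim (ℕ.<-irrefl refl (ℕ.<-≤-trans k>len (ℕ.≤-pred (F.toℕ<n k))))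

module TourByComputation {m : ℕ} (rest : List (Label (4 + m))) where

  labels : List (Label (4 + m))
  labels = first ∷ rest

  _≟ˡ_ : (l l′ : Label (4 + m)) → Dec (l ≡ l′)
  _≟ˡ_ = ×-≡-dec F._≟_ F._≟_

  ordered? : Dec (All Ordered labels)
  ordered? = All.all? (λ l → proj₁ l F.<? proj₂ l) labels

  labels-unique? : Dec (Unique labels)
  labels-unique? = UniqueDec.unique? _≟ˡ_ labels

  covers? : Dec (∀ i j → i F.< j → (i , j) ∈ labels)
  covers? = F.all? λ i → F.all? λ j → (i F.<? j) →-dec Membership._∈?_ _≟ˡ_ (i , j) labels

  closed? : Dec (walkEnd (identity _) labels ≡ identity _)
  closed? = V.≡-dec F._≟_ (walkEnd (identity _) labels) (identity _)

  walk-unique? : Dec (Unique (walk (identity _) labels))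
  walk-unique? = UniqueDec.unique? (V.≡-dec F._≟_) (walk (identity _) labels)

-- Extending a rainbow tour by four positions

∸-suc : ∀ a k → suc k ≤ a → a ∸ k ≡ suc (a ∸ suc k)
∸-suc (suc a) zero    _         = refl
∸-suc (suc a) (suc k) (s≤s k<a) = ∸-suc a k k<a

≡ᵇ-refl : ∀ a → (a ≡ᵇ a) ≡ true
≡ᵇ-refl zero    = refl
≡ᵇ-refl (suc a) = ≡ᵇ-refl a

≢⇒≡ᵇ-false : ∀ a b → a ≢ b → (a ≡ᵇ b) ≡ false
≢⇒≡ᵇ-false zero    zero    a≢b = ⊥-elim (a≢b refl)
≢⇒≡ᵇ-false zero    (suc b) _   = refl
≢⇒≡ᵇ-false (suc a) zero    _   = refl
≢⇒≡ᵇ-false (suc a) (suc b) a≢b = ≢⇒≡ᵇ-false a b (a≢b ∘ cong suc)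

<⇒<ᵇ-true : ∀ {a b} → a < b → (a <ᵇ b) ≡ true
<⇒<ᵇ-true {zero}  {suc b} _         = refl
<⇒<ᵇ-true {suc a} {suc b} (s≤s a<b) = <⇒<ᵇ-true a<b

≥⇒<ᵇ-false : ∀ {a b} → b ≤ a → (a <ᵇ b) ≡ false
≥⇒<ᵇ-false {a}     {zero}  _         = refl
≥⇒<ᵇ-false {suc a} {suc b} (s≤s b≤a) = ≥⇒<ᵇ-false b≤a

-- After the sweep old position k holds τ k: the values 1, 0 followed by the old values moved
-- two positions up.
τ : ℕ → ℕ
τ 0             = 1
τ 1             = 0
τ (suc (suc k)) = 4 + k

τ⁻¹ : ℕ → ℕ
τ⁻¹ 0                         = 1
τ⁻¹ (suc (suc (suc (suc k)))) = 2 + k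
τ⁻¹ _                         = 0

τ⁻¹-τ : ∀ k → τ⁻¹ (τ k) ≡ k
τ⁻¹-τ 0             = refl
τ⁻¹-τ 1             = refl
τ⁻¹-τ (suc (suc k)) = refl

τ≢2 : ∀ k → (τ k ≡ᵇ 2) ≡ false
τ≢2 0             = refl
τ≢2 1             = refl
τ≢2 (suc (suc k)) = refl

τ≢3 : ∀ k → (τ k ≡ᵇ 3) ≡ false
τ≢3 0             = refl
τ≢3 1             = refl
τ≢3 (suc (suc k)) = refl

swept : ℕ → ℕ → ℕ
swept k i = if i <ᵇ k then τ i else 4 + i

swept′ : ℕ → ℕ → ℕ
swept′ k i = if i <ᵇ k then τ i else (if i ≡ᵇ k then τ (suc k) else 4 + i)

swept-< : ∀ {k i} → i < k → swept k i ≡ τ i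
swept-< {k} {i} i<k rewrite <⇒<ᵇ-true i<k = refl

swept-self : ∀ k → swept k k ≡ 4 + k
swept-self k rewrite ≥⇒<ᵇ-false (ℕ.≤-refl {k}) = refl

swept-suc-self : ∀ k → swept (suc k) k ≡ τ k
swept-suc-self k = swept-< (ℕ.n<1+n k)

swept′-self : ∀ k → swept′ k k ≡ τ (suc k)
swept′-self k rewrite ≥⇒<ᵇ-false (ℕ.≤-refl {k}) | ≡ᵇ-refl k = refl

swept′≡swept : ∀ k i → i ≢ k → swept′ k i ≡ swept k i
swept′≡swept k i i≢k with ℕ.<-cmp i k
... | tri< i<k _ _ rewrite <⇒<ᵇ-true i<k = refl
... | tri≈ _ i≡k _ = ⊥-elim (i≢k i≡k)
... | tri> _ _ i>k rewrite ≥⇒<ᵇ-false (ℕ.<⇒≤ i>k) | ≢⇒≡ᵇ-false i k i≢k = refl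

swept-suc≡swept′ : ∀ k i → i ≢ k → swept (suc k) i ≡ swept′ k i
swept-suc≡swept′ k i i≢k with ℕ.<-cmp i k
... | tri< i<k _ _ rewrite <⇒<ᵇ-true i<k | <⇒<ᵇ-true (ℕ.m<n⇒m<1+n i<k) = refl
... | tri≈ _ i≡k _ = ⊥-elim (i≢k i≡k)
... | tri> _ _ i>k rewrite ≥⇒<ᵇ-false (ℕ.<⇒≤ i>k) | ≥⇒<ᵇ-false i>k | ≢⇒≡ᵇ-false i k i≢k = refl

swap₂₃ : ℕ → ℕ
swap₂₃ 2 = 3
swap₂₃ 3 = 2
swap₂₃ x = x

exchanged-swap₂₃ : Exchanged id 2 3 swap₂₃
exchanged-swap₂₃ = exchanged refl refl λ where
  0 _ _ → refl
  1 _ _ → refl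
  2 x≢2 _ → ⊥-elim (x≢2 refl)
  3 _ x≢3 → ⊥-elim (x≢3 refl)
  (suc (suc (suc (suc x)))) _ _ → refl

lift₄ : (ℕ → ℕ) → ℕ → ℕ
lift₄ g 0 = 0
lift₄ g 1 = 1
lift₄ g 2 = 2
lift₄ g 3 = 3
lift₄ g (suc (suc (suc (suc x)))) = 4 + g x

liftVertex : ∀ {n} → Vertex n → Vertex (4 + n)
liftVertex w = 0F ∷ 1F ∷ 2F ∷ 3F ∷ V.map (4 ↑ʳ_) w

liftLabel : ∀ {n} → Label n → Label (4 + n)
liftLabel (i , j) = 4 ↑ʳ i , 4 ↑ʳ j

liftVertex-swap : ∀ {n} (w : Vertex n) i j → swap (liftVertex w) (4 ↑ʳ i) (4 ↑ʳ j) ≡ liftVertex (swap w i j)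
liftVertex-swap w i j = cong (λ z → 0F ∷ 1F ∷ 2F ∷ 3F ∷ z) (begin
    (V.map (4 ↑ʳ_) w [ i ]≔ lookup (V.map (4 ↑ʳ_) w) j) [ j ]≔ lookup (V.map (4 ↑ʳ_) w) i
      ≡⟨ cong₂ (λ a b → (V.map (4 ↑ʳ_) w [ i ]≔ a) [ j ]≔ b) (V.lookup-map j (4 ↑ʳ_) w) (V.lookup-map i (4 ↑ʳ_) w) ⟩
    (V.map (4 ↑ʳ_) w [ i ]≔ (4 ↑ʳ lookup w j)) [ j ]≔ (4 ↑ʳ lookup w i)
      ≡⟨ cong (_[ j ]≔ (4 ↑ʳ lookup w i)) (sym (V.map-[]≔ (4 ↑ʳ_) w i)) ⟩
    V.map (4 ↑ʳ_) (w [ i ]≔ lookup w j) [ j ]≔ (4 ↑ʳ lookup w i)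
      ≡⟨ sym (V.map-[]≔ (4 ↑ʳ_) (w [ i ]≔ lookup w j) j) ⟩
    V.map (4 ↑ʳ_) (swap w i j) ∎)
  where open ≡-Reasoning

walk-lift : ∀ {n} (w : Vertex n) ls → walk (liftVertex w) (map liftLabel ls) ≡ map liftVertex (walk w ls)
walk-lift w []             = refl
walk-lift w ((i , j) ∷ ls) =
  cong (liftVertex w ∷_) (trans (cong (λ z → walk z (map liftLabel ls)) (liftVertex-swap w i j)) (walk-lift (swap w i j) ls))

walkEnd-lift : ∀ {n} (w : Vertex n) ls → walkEnd (liftVertex w) (map liftLabel ls) ≡ liftVertex (walkEnd w ls)
walkEnd-lift w []             = refl
walkEnd-lift w ((i , j) ∷ ls) =
  trans (cong (λ z → walkEnd z (map liftLabel ls)) (liftVertex-swap w i j)) (walkEnd-lift (swap w i j) ls)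

liftVertex-identity : ∀ n → liftVertex (identity n) ≡ identity (4 + n)
liftVertex-identity n = cong (λ z → 0F ∷ 1F ∷ 2F ∷ 3F ∷ z) (sym (V.tabulate-∘ (4 ↑ʳ_) id))

liftVertex-injective : ∀ {n} {w w′ : Vertex n} → liftVertex w ≡ liftVertex w′ → w ≡ w′
liftVertex-injective {n} {w} {w′} eq = Vec-ext λ p → F.↑ʳ-injective 4 _ _ (begin
  4 ↑ʳ lookup w p                 ≡⟨ sym (V.lookup-map p (4 ↑ʳ_) w) ⟩
  lookup (liftVertex w) (4 ↑ʳ p)  ≡⟨ cong (λ v → lookup v (4 ↑ʳ p)) eq ⟩
  lookup (liftVertex w′) (4 ↑ʳ p) ≡⟨ V.lookup-map p (4 ↑ʳ_) w′ ⟩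
  4 ↑ʳ lookup w′ p                ∎)
  where open ≡-Reasoning

liftLabel-injective : ∀ {n} {x y : Label n} → liftLabel x ≡ liftLabel y → x ≡ y
liftLabel-injective {x = _ , _} {_ , _} eq =
  cong₂ _,_ (F.↑ʳ-injective 4 _ _ (cong proj₁ eq)) (F.↑ʳ-injective 4 _ _ (cong proj₂ eq))

realises-liftVertex : ∀ {n} {w : Vertex n} {g} → Realises w g → Realises (liftVertex w) (lift₄ g)
realises-liftVertex w⊨g 0F = refl
realises-liftVertex w⊨g 1F = refl
realises-liftVertex w⊨g 2F = refl
realises-liftVertex w⊨g 3F = refl
realises-liftVertex {w = w} w⊨g (fs (fs (fs (fs i)))) =
  trans (cong toℕ (V.lookup-map i (4 ↑ʳ_) w)) (trans (F.toℕ-↑ʳ 4 (lookup w i)) (cong (4 +_) (w⊨g i)))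

-- Positions 0–3 are the new ones; old position i becomes 4 + i.
module Extension (m : ℕ) where

  n N : ℕ
  n = 4 + m
  N = 4 + n

  -- The vertices of the detour by their entries: fwd k and fwd′ k before and halfway through
  -- the flips of old position k on the way up, bwd (suc k) and bwd′ k on the way down.
  fwd fwd′ bwd bwd′ : ℕ → ℕ → ℕ
  mid₁ mid₂ end₁ end₂ : ℕ → ℕ

  fwd k 0 = τ (suc k)
  fwd k 1 = τ k
  fwd k 2 = 3
  fwd k 3 = 2
  fwd k (suc (suc (suc (suc i)))) = swept k i

  fwd′ k 0 = τ (suc (suc k))
  fwd′ k 1 = τ k
  fwd′ k 2 = 3
  fwd′ k 3 = 2
  fwd′ k (suc (suc (suc (suc i)))) = swept′ k i

  mid₁ 0 = τ n
  mid₁ 1 = τ (suc n)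
  mid₁ 2 = 3
  mid₁ 3 = 2
  mid₁ (suc (suc (suc (suc i)))) = swept n i

  mid₂ 0 = τ n
  mid₂ 1 = 2
  mid₂ 2 = 3
  mid₂ 3 = τ (suc n)
  mid₂ (suc (suc (suc (suc i)))) = swept n i

  bwd j 0 = 3
  bwd j 1 = 2
  bwd j 2 = τ j
  bwd j 3 = τ (suc j)
  bwd j (suc (suc (suc (suc i)))) = swept j i

  bwd′ k 0 = 3
  bwd′ k 1 = 2
  bwd′ k 2 = τ k
  bwd′ k 3 = τ (suc (suc k))
  bwd′ k (suc (suc (suc (suc i)))) = swept′ k i

  end₁ 0 = 3
  end₁ 1 = 2
  end₁ 2 = 1
  end₁ 3 = 0
  end₁ (suc (suc (suc (suc i)))) = 4 + swap₂₃ i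

  end₂ 0 = 0
  end₂ 1 = 2
  end₂ 2 = 1
  end₂ 3 = 3
  end₂ (suc (suc (suc (suc i)))) = 4 + swap₂₃ i

  -- Indices along the detour: fwd k is visited at 2k + 1, fwd′ k at 2k + 2, mid₁ and mid₂ at
  -- 2n + 2 and 2n + 3, bwd j at bwdIndex j, bwd′ k at bwdIndex (suc k) + 1, end₁ and end₂ at
  -- 4n + 5 and 4n + 6; the vertices of the lifted tour, which fix 0, 1, 2, 3, get index 0.
  -- The index is recovered from the entries at positions 0, 1, 2, 3 and 6.
  bwdIndex : ℕ → ℕ
  bwdIndex j = 4 + (n + n) + ((n ∸ j) + (n ∸ j))

  indexFromFwd : ℕ → ℕ → ℕ
  indexFromFwd a b = if τ⁻¹ a ≡ᵇ suc (τ⁻¹ b) then suc (τ⁻¹ b + τ⁻¹ b)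
                     else (if τ⁻¹ a ≡ᵇ suc (suc (τ⁻¹ b)) then suc (suc (τ⁻¹ b + τ⁻¹ b)) else suc (suc (n + n)))

  indexFromBwd : ℕ → ℕ → ℕ → ℕ
  indexFromBwd c d e = if τ⁻¹ d ≡ᵇ suc (τ⁻¹ c)
                       then (if τ⁻¹ c ≡ᵇ 0 then (if e ≡ᵇ 7 then 5 + (n + n) + (n + n) else bwdIndex 0) else bwdIndex (τ⁻¹ c))
                       else suc (bwdIndex (suc (τ⁻¹ c)))

  indexFrom : ℕ → ℕ → ℕ → ℕ → ℕ → ℕ
  indexFrom a b c d e = if a ≡ᵇ 3 then indexFromBwd c d e
                        else (if b ≡ᵇ 2 then (if c ≡ᵇ 3 then 3 + (n + n) else 6 + (n + n) + (n + n))
                              else (if c ≡ᵇ 2 then 0 else indexFromFwd a b))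

  indexOf : (ℕ → ℕ) → ℕ
  indexOf f = indexFrom (f 0) (f 1) (f 2) (f 3) (f 6)

  code : Vertex N → ℕ
  code v = indexFrom (entry 0F) (entry 1F) (entry 2F) (entry 3F) (entry 6F)
    where
    entry : Fin N → ℕ
    entry p = toℕ (lookup v p)

  code-realises : ∀ {v f} → Realises v f → code v ≡ indexOf f
  code-realises {v} {f} v⊨f rewrite v⊨f 0F | v⊨f 1F | v⊨f 2F | v⊨f 3F | v⊨f 6F = refl

  indexOf-fwd : ∀ k → indexOf (fwd k) ≡ suc (k + k)
  indexOf-fwd k rewrite τ≢3 (suc k) | τ≢2 k | τ⁻¹-τ (suc k) | τ⁻¹-τ k | ≡ᵇ-refl k = refl

  indexOf-fwd′ : ∀ k → indexOf (fwd′ k) ≡ suc (suc (k + k))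
  indexOf-fwd′ k rewrite τ≢2 k | τ⁻¹-τ k | ≢⇒≡ᵇ-false (suc k) k ℕ.1+n≢n | ≡ᵇ-refl k = refl

  indexOf-mid₁ : indexOf mid₁ ≡ suc (suc (n + n))
  indexOf-mid₁ rewrite ≢⇒≡ᵇ-false m (2 + m) (ℕ.<⇒≢ (ℕ.m<n+m m z<s))
                     | ≢⇒≡ᵇ-false m (3 + m) (ℕ.<⇒≢ (ℕ.m<n+m m z<s)) = refl

  indexOf-mid₂ : indexOf mid₂ ≡ 3 + (n + n)
  indexOf-mid₂ = refl

  indexOf-bwd : ∀ j → indexOf (bwd j) ≡ bwdIndex j
  indexOf-bwd zero    = refl
  indexOf-bwd (suc j) rewrite τ⁻¹-τ (suc j) | τ⁻¹-τ (suc (suc j)) | ≡ᵇ-refl j = refl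

  indexOf-bwd′ : ∀ k → indexOf (bwd′ k) ≡ suc (bwdIndex (suc k))
  indexOf-bwd′ k rewrite τ⁻¹-τ k | ≢⇒≡ᵇ-false (suc k) k ℕ.1+n≢n = refl

  indexOf-end₁ : indexOf end₁ ≡ 5 + (n + n) + (n + n)
  indexOf-end₁ = refl

  indexOf-end₂ : indexOf end₂ ≡ 6 + (n + n) + (n + n)
  indexOf-end₂ = refl

  ≢-old : ∀ {i k} → 4 + i ≢ 4 + k → i ≢ k
  ≢-old 4+i≢4+k i≡k = 4+i≢4+k (cong (4 +_) i≡k)

  start⇄fwd : Exchanged id 2 3 (fwd 0)
  start⇄fwd = exchanged refl refl λ where
    0 _ _ → refl
    1 _ _ → refl
    2 x≢2 _ → ⊥-elim (x≢2 refl)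
    3 _ x≢3 → ⊥-elim (x≢3 refl)
    (suc (suc (suc (suc i)))) _ _ → refl

  fwd⇄fwd′ : ∀ k → Exchanged (fwd k) 0 (4 + k) (fwd′ k)
  fwd⇄fwd′ k = exchanged (sym (swept-self k)) (swept′-self k) λ where
    0 x≢0 _ → ⊥-elim (x≢0 refl)
    1 _ _ → refl
    2 _ _ → refl
    3 _ _ → refl
    (suc (suc (suc (suc i)))) _ x≢k → swept′≡swept k i (≢-old x≢k)

  fwd′⇄fwd : ∀ k → Exchanged (fwd′ k) 1 (4 + k) (fwd (suc k))
  fwd′⇄fwd k = exchanged (sym (swept′-self k)) (swept-suc-self k) λ where
    0 _ _ → refl
    1 x≢1 _ → ⊥-elim (x≢1 refl)
    2 _ _ → refl
    3 _ _ → refl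
    (suc (suc (suc (suc i)))) _ x≢k → swept-suc≡swept′ k i (≢-old x≢k)

  fwd⇄mid₁ : Exchanged (fwd n) 0 1 mid₁
  fwd⇄mid₁ = exchanged refl refl λ where
    0 x≢0 _ → ⊥-elim (x≢0 refl)
    1 _ x≢1 → ⊥-elim (x≢1 refl)
    2 _ _ → refl
    3 _ _ → refl
    (suc (suc (suc (suc i)))) _ _ → refl

  mid₁⇄mid₂ : Exchanged mid₁ 1 3 mid₂
  mid₁⇄mid₂ = exchanged refl refl λ where
    0 _ _ → refl
    1 x≢1 _ → ⊥-elim (x≢1 refl)
    2 _ _ → refl
    3 _ x≢3 → ⊥-elim (x≢3 refl)
    (suc (suc (suc (suc i)))) _ _ → refl

  mid₂⇄bwd : Exchanged mid₂ 0 2 (bwd n)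
  mid₂⇄bwd = exchanged refl refl λ where
    0 x≢0 _ → ⊥-elim (x≢0 refl)
    1 _ _ → refl
    2 _ x≢2 → ⊥-elim (x≢2 refl)
    3 _ _ → refl
    (suc (suc (suc (suc i)))) _ _ → refl

  bwd⇄bwd′ : ∀ k → Exchanged (bwd (suc k)) 2 (4 + k) (bwd′ k)
  bwd⇄bwd′ k = exchanged (sym (swept-suc-self k)) (swept′-self k) λ where
    0 _ _ → refl
    1 _ _ → refl
    2 x≢2 _ → ⊥-elim (x≢2 refl)
    3 _ _ → refl
    (suc (suc (suc (suc i)))) _ x≢k → sym (swept-suc≡swept′ k i (≢-old x≢k))

  bwd′⇄bwd : ∀ k → Exchanged (bwd′ k) 3 (4 + k) (bwd k)
  bwd′⇄bwd k = exchanged (sym (swept′-self k)) (swept-self k) λ where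
    0 _ _ → refl
    1 _ _ → refl
    2 _ _ → refl
    3 x≢3 _ → ⊥-elim (x≢3 refl)
    (suc (suc (suc (suc i)))) _ x≢k → sym (swept′≡swept k i (≢-old x≢k))

  bwd⇄end₁ : Exchanged (bwd 0) 6 7 end₁
  bwd⇄end₁ = exchanged refl refl λ where
    0 _ _ → refl
    1 _ _ → refl
    2 _ _ → refl
    3 _ _ → refl
    4 _ _ → refl
    5 _ _ → refl
    6 x≢6 _ → ⊥-elim (x≢6 refl)
    7 _ x≢7 → ⊥-elim (x≢7 refl)
    (suc (suc (suc (suc (suc (suc (suc (suc i)))))))) _ _ → refl

  end₁⇄end₂ : Exchanged end₁ 0 3 end₂
  end₁⇄end₂ = exchanged refl refl λ where
    0 x≢0 _ → ⊥-elim (x≢0 refl)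
    1 _ _ → refl
    2 _ _ → refl
    3 _ x≢3 → ⊥-elim (x≢3 refl)
    (suc (suc (suc (suc i)))) _ _ → refl

  end₂⇄lifted : Exchanged end₂ 1 2 (lift₄ swap₂₃)
  end₂⇄lifted = exchanged refl refl λ where
    0 _ _ → refl
    1 x≢1 _ → ⊥-elim (x≢1 refl)
    2 _ x≢2 → ⊥-elim (x≢2 refl)
    3 _ _ → refl
    (suc (suc (suc (suc i)))) _ _ → refl

  old : ∀ {k} → k < n → Fin N
  old k<n = 4 ↑ʳ fromℕ< k<n

  toℕ-old : ∀ {k} (k<n : k < n) → toℕ (old k<n) ≡ 4 + k
  toℕ-old k<n = cong (4 +_) (F.toℕ-fromℕ< k<n)

  old≡ : ∀ {k} (k<n : k < n) (j : Fin n) → k ≡ toℕ j → old k<n ≡ 4 ↑ʳ j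
  old≡ k<n j refl = cong (4 ↑ʳ_) (F.fromℕ<-toℕ j k<n)

  <n-of-+ : ∀ k d → k + suc d ≡ n → k < n
  <n-of-+ k d k+d≡n = subst (k <_) k+d≡n (ℕ.m<m+n k z<s)

  +-suc-shift : ∀ {k d} → k + suc d ≡ n → suc k + d ≡ n
  +-suc-shift {k} {d} = trans (sym (ℕ.+-suc k d))

  sweepUp : ∀ k d → k + d ≡ n → List (Label N)
  sweepUp k zero    _       = []
  sweepUp k (suc d) k+d≡n = (0F , old k<n) ∷ (1F , old k<n) ∷ sweepUp (suc k) d (+-suc-shift k+d≡n)
    where k<n = <n-of-+ k d k+d≡n

  sweepDown : ∀ j → j ≤ n → List (Label N)
  sweepDown zero    _   = []
  sweepDown (suc k) k<n = (2F , old k<n) ∷ (3F , old k<n) ∷ sweepDown k (ℕ.<⇒≤ k<n)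

  middle closing : List (Label N)
  middle  = (0F , 1F) ∷ (1F , 3F) ∷ (0F , 2F) ∷ []
  closing = (6F , 7F) ∷ (0F , 3F) ∷ (1F , 2F) ∷ []

  open CodedWalks code

  visit : ∀ {c f h g ls a b} (i j : Fin N) → toℕ i ≡ a → toℕ j ≡ b → indexOf f ≡ c →
          Exchanged f a b h → CodedWalk (suc c) h ls g → CodedWalk c f ((i , j) ∷ ls) g
  visit {f = f} i j i≡a j≡b f#c = coded-∷ i j i≡a j≡b (λ v v⊨f → trans (code-realises {v} {f} v⊨f) f#c)

  coded-sweepUp : ∀ k d k+d≡n → CodedWalk (suc (k + k)) (fwd k) (sweepUp k d k+d≡n) (fwd n)
  coded-sweepUp k zero    k+d≡n = coded-[] (λ x → cong (λ z → fwd z x) (trans (sym (ℕ.+-identityʳ k)) k+d≡n))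
  coded-sweepUp k (suc d) k+d≡n =
    visit 0F (old k<n) refl (toℕ-old k<n) (indexOf-fwd k) (fwd⇄fwd′ k)
      (visit 1F (old k<n) refl (toℕ-old k<n) (indexOf-fwd′ k) (fwd′⇄fwd k)
        (coded-cast (cong (suc ∘ suc) (ℕ.+-suc k k)) (coded-sweepUp (suc k) d (+-suc-shift k+d≡n))))
    where k<n = <n-of-+ k d k+d≡n

  bwdIndex-pred : ∀ k → suc k ≤ n → bwdIndex k ≡ suc (suc (bwdIndex (suc k)))
  bwdIndex-pred k k<n rewrite ∸-suc n k k<n =
    trans (cong (λ z → 4 + (n + n) + z) (ℕ.+-suc (suc (n ∸ suc k)) (n ∸ suc k)))
          (trans (ℕ.+-suc (4 + (n + n)) _) (cong suc (ℕ.+-suc (4 + (n + n)) _)))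

  coded-sweepDown : ∀ j (j≤n : j ≤ n) → CodedWalk (bwdIndex j) (bwd j) (sweepDown j j≤n) (bwd 0)
  coded-sweepDown zero    _   = coded-[] (λ _ → refl)
  coded-sweepDown (suc k) k<n =
    visit 2F (old k<n) refl (toℕ-old k<n) (indexOf-bwd (suc k)) (bwd⇄bwd′ k)
      (visit 3F (old k<n) refl (toℕ-old k<n) (indexOf-bwd′ k) (bwd′⇄bwd k)
        (coded-cast (bwdIndex-pred k k<n) (coded-sweepDown k (ℕ.<⇒≤ k<n))))

  coded-middle : CodedWalk (suc (n + n)) (fwd n) middle (bwd n)
  coded-middle =
    visit 0F 1F refl refl (indexOf-fwd n) fwd⇄mid₁
      (visit 1F 3F refl refl indexOf-mid₁ mid₁⇄mid₂
        (visit 0F 2F refl refl indexOf-mid₂ mid₂⇄bwd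
          (coded-[] (λ _ → refl))))

  coded-closing : CodedWalk (bwdIndex 0) (bwd 0) closing (lift₄ swap₂₃)
  coded-closing =
    visit 6F 7F refl refl (indexOf-bwd 0) bwd⇄end₁
      (visit 0F 3F refl refl indexOf-end₁ end₁⇄end₂
        (visit 1F 2F refl refl indexOf-end₂ end₂⇄lifted
          (coded-[] (λ _ → refl))))

  -- The index along the detour of the vertex at which the label is used.
  labelIndex : ℕ → ℕ → ℕ
  labelIndex 2 3 = 0
  labelIndex 0 1 = suc (n + n)
  labelIndex 1 3 = suc (suc (n + n))
  labelIndex 0 2 = 3 + (n + n)
  labelIndex 0 3 = 5 + (n + n) + (n + n)
  labelIndex 1 2 = 6 + (n + n) + (n + n)
  labelIndex 0 (suc (suc (suc (suc k)))) = suc (k + k)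
  labelIndex 1 (suc (suc (suc (suc k)))) = suc (suc (k + k))
  labelIndex 2 (suc (suc (suc (suc k)))) = bwdIndex (suc k)
  labelIndex 3 (suc (suc (suc (suc k)))) = suc (bwdIndex (suc k))
  labelIndex 6 7 = bwdIndex 0
  labelIndex _ _ = 0

  indexOfLabel : Label N → ℕ
  indexOfLabel (i , j) = labelIndex (toℕ i) (toℕ j)

  numbered-sweepUp : ∀ k d k+d≡n → Numbered indexOfLabel (suc (k + k)) (sweepUp k d k+d≡n)
  numbered-sweepUp k zero    _ = refl
  numbered-sweepUp k (suc d) k+d≡n rewrite F.toℕ-fromℕ< (<n-of-+ k d k+d≡n) =
    cong (λ z → suc (k + k) ∷ suc (suc (k + k)) ∷ z)
      (trans (numbered-sweepUp (suc k) d (+-suc-shift k+d≡n))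
             (cong (λ z → L.iterate suc (suc (suc z)) (length (sweepUp (suc k) d (+-suc-shift k+d≡n)))) (ℕ.+-suc k k)))

  numbered-sweepDown : ∀ j j≤n → Numbered indexOfLabel (bwdIndex j) (sweepDown j j≤n)
  numbered-sweepDown zero    _   = refl
  numbered-sweepDown (suc k) k<n rewrite F.toℕ-fromℕ< k<n =
    cong (λ z → bwdIndex (suc k) ∷ suc (bwdIndex (suc k)) ∷ z)
      (trans (numbered-sweepDown k (ℕ.<⇒≤ k<n)) (cong (λ z → L.iterate suc z (length (sweepDown k (ℕ.<⇒≤ k<n)))) (bwdIndex-pred k k<n)))

  New : Label N → Set
  New (i , j) = i F.< j × toℕ i < 4

  sweepUp-new : ∀ k d k+d≡n → All New (sweepUp k d k+d≡n)
  sweepUp-new k zero    _     = All.[]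
  sweepUp-new k (suc d) k+d≡n = (s≤s z≤n , s≤s z≤n) All.∷ (s≤s (s≤s z≤n) , s≤s (s≤s z≤n)) All.∷ sweepUp-new (suc k) d (+-suc-shift k+d≡n)

  sweepDown-new : ∀ j j≤n → All New (sweepDown j j≤n)
  sweepDown-new zero    _   = All.[]
  sweepDown-new (suc k) k<n = (s≤s (s≤s (s≤s z≤n)) , s≤s (s≤s (s≤s z≤n)))
                      All.∷ (s≤s (s≤s (s≤s (s≤s z≤n))) , s≤s (s≤s (s≤s (s≤s z≤n)))) All.∷ sweepDown-new k _

  ∈-sweepUp : ∀ k d k+d≡n (j : Fin n) → k ≤ toℕ j →
              ((0F , 4 ↑ʳ j) ∈ sweepUp k d k+d≡n) × ((1F , 4 ↑ʳ j) ∈ sweepUp k d k+d≡n)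
  ∈-sweepUp k zero    k+d≡n j k≤j = ⊥-elim (ℕ.<-irrefl refl (ℕ.≤-trans (s≤s k≤j)
    (subst (suc (toℕ j) ≤_) (trans (sym k+d≡n) (ℕ.+-identityʳ k)) (F.toℕ<n j))))
  ∈-sweepUp k (suc d) k+d≡n j k≤j with ℕ.<-cmp k (toℕ j)
  ... | tri≈ _ k≡j _ = here (cong (0F ,_) (sym (old≡ (<n-of-+ k d k+d≡n) j k≡j))) , there (here (cong (1F ,_) (sym (old≡ (<n-of-+ k d k+d≡n) j k≡j))))
  ... | tri< k<j _ _ = let (a , b) = ∈-sweepUp (suc k) d (+-suc-shift k+d≡n) j k<j in there (there a) , there (there b)
  ... | tri> _ _ k>j = ⊥-elim (ℕ.<-irrefl refl (ℕ.<-≤-trans k>j k≤j))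

  ∈-sweepDown : ∀ k k≤n (j : Fin n) → toℕ j < k →
                ((2F , 4 ↑ʳ j) ∈ sweepDown k k≤n) × ((3F , 4 ↑ʳ j) ∈ sweepDown k k≤n)
  ∈-sweepDown (suc k) k<n j (s≤s j≤k) with ℕ.<-cmp k (toℕ j)
  ... | tri≈ _ k≡j _ = here (cong (2F ,_) (sym (old≡ k<n j k≡j))) , there (here (cong (3F ,_) (sym (old≡ k<n j k≡j))))
  ... | tri< k<j _ _ = ⊥-elim (ℕ.<-irrefl refl (ℕ.<-≤-trans k<j j≤k))
  ... | tri> _ _ k>j = let (a , b) = ∈-sweepDown k (ℕ.<⇒≤ k<n) j k>j in there (there a) , there (there b)

  length-sweepUp : ∀ k d k+d≡n → length (sweepUp k d k+d≡n) ≡ d + d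
  length-sweepUp k zero    _     = refl
  length-sweepUp k (suc d) k+d≡n =
    cong suc (trans (cong suc (length-sweepUp (suc k) d (+-suc-shift k+d≡n))) (sym (ℕ.+-suc d d)))

  length-sweepDown : ∀ j j≤n → length (sweepDown j j≤n) ≡ j + j
  length-sweepDown zero    _   = refl
  length-sweepDown (suc k) k<n = cong suc (trans (cong suc (length-sweepDown k (ℕ.<⇒≤ k<n))) (sym (ℕ.+-suc k k)))

  up down : List (Label N)
  up   = sweepUp 0 n refl
  down = sweepDown n ℕ.≤-refl

  length-up : length up ≡ n + n
  length-up = length-sweepUp 0 n refl

  length-down : length down ≡ n + n
  length-down = length-sweepDown n ℕ.≤-refl

  coded-up : CodedWalk 1 (fwd 0) up (fwd n)
  coded-up = coded-sweepUp 0 n refl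

  coded-down : CodedWalk (bwdIndex n) (bwd n) down (bwd 0)
  coded-down = coded-sweepDown n ℕ.≤-refl

  numbered-up : Numbered indexOfLabel 1 up
  numbered-up = numbered-sweepUp 0 n refl

  numbered-down : Numbered indexOfLabel (bwdIndex n) down
  numbered-down = numbered-sweepDown n ℕ.≤-refl

  up-new : All New up
  up-new = sweepUp-new 0 n refl

  down-new : All New down
  down-new = sweepDown-new n ℕ.≤-refl

  ∈-up : ∀ (j : Fin n) → ((0F , 4 ↑ʳ j) ∈ up) × ((1F , 4 ↑ʳ j) ∈ up)
  ∈-up j = ∈-sweepUp 0 n refl j z≤n

  ∈-down : ∀ (j : Fin n) → ((2F , 4 ↑ʳ j) ∈ down) × ((3F , 4 ↑ʳ j) ∈ down)
  ∈-down j = ∈-sweepDown n ℕ.≤-refl j (F.toℕ<n j)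

  detour : List (Label N)
  detour = up ++ (middle ++ (down ++ closing))

  bwdIndex-n : bwdIndex n ≡ suc (n + n) + 3
  bwdIndex-n rewrite ℕ.n∸n≡0 n = trans (ℕ.+-identityʳ (4 + (n + n))) (trans (ℕ.+-comm 4 (n + n)) (ℕ.+-suc (n + n) 3))

  bwdIndex-0 : suc (n + n) + 3 + length down ≡ bwdIndex 0
  bwdIndex-0 rewrite length-down = cong (λ z → suc z + (n + n)) (ℕ.+-comm (n + n) 3)

  middle-start : 1 + length up ≡ suc (n + n)
  middle-start = cong suc length-up

  coded-detour : CodedWalk 0 id (first ∷ detour) (lift₄ swap₂₃)
  coded-detour = visit 2F 3F refl refl refl start⇄fwd
    (coded-++ up (middle ++ (down ++ closing)) coded-up
      (coded-cast (sym middle-start) (coded-++ middle (down ++ closing) coded-middle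
        (coded-++ down closing (coded-cast bwdIndex-n coded-down) (coded-cast (sym bwdIndex-0) coded-closing)))))

  numbered-detour : Numbered indexOfLabel 0 (first ∷ detour)
  numbered-detour = cong (0 ∷_) (numbered-++ up (middle ++ (down ++ closing)) numbered-up
    (subst (λ c → Numbered indexOfLabel c (middle ++ (down ++ closing))) (sym middle-start)
      (numbered-++ middle (down ++ closing) refl
        (numbered-++ down closing (subst (λ c → Numbered indexOfLabel c down) bwdIndex-n numbered-down)
          (subst (λ c → Numbered indexOfLabel c closing) (sym bwdIndex-0) refl)))))

  module _ (T : RainbowTour m) where
    open RainbowTour T

    lifted : List (Label N)
    lifted = map liftLabel rest

    start : Vertex n
    start = flip (identity n) first

    detour-run : Numbered code 0 (walk (identity N) (first ∷ detour))
               × Realises (walkEnd (identity N) (first ∷ detour)) (lift₄ swap₂₃)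
    detour-run = run coded-detour (identity N) (realises-identity N)

    walkEnd-detour : walkEnd (identity N) (first ∷ detour) ≡ liftVertex start
    walkEnd-detour = realises-unique {v = walkEnd (identity N) (first ∷ detour)} {f = lift₄ swap₂₃} (proj₂ detour-run)
      (realises-liftVertex {w = start} {g = swap₂₃} (realises-swap {v = identity n} 2F 3F refl refl (realises-identity n) exchanged-swap₂₃))

    closed′ : walkEnd (identity N) (first ∷ detour ++ lifted) ≡ identity N
    closed′ = begin
      walkEnd (identity N) ((first ∷ detour) ++ lifted)               ≡⟨ L.foldl-++ flip (identity N) (first ∷ detour) lifted ⟩
      walkEnd (walkEnd (identity N) (first ∷ detour)) lifted          ≡⟨ cong (λ v → walkEnd v lifted) walkEnd-detour ⟩
      walkEnd (liftVertex start) lifted                               ≡⟨ walkEnd-lift start rest ⟩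
      liftVertex (walkEnd start rest)                                 ≡⟨ cong liftVertex closed ⟩
      liftVertex (identity n)                                         ≡⟨ liftVertex-identity n ⟩
      identity N                                                      ∎
      where open ≡-Reasoning

    walk-split : walk (identity N) (first ∷ detour ++ lifted) ≡ walk (identity N) (first ∷ detour) ++ map liftVertex (walk start rest)
    walk-split = trans (walk-++ (identity N) (first ∷ detour) lifted)
      (cong (walk (identity N) (first ∷ detour) ++_) (trans (cong (λ v → walk v lifted) walkEnd-detour) (walk-lift start rest)))

    identity∉walk : ¬ (identity n ∈ walk start rest)
    identity∉walk with walk-unique
    ... | identity∉ AllPairs.∷ _ = λ p → All.lookup identity∉ p refl

    -- Vertices of the lifted walk fix 0, 1, 2, 3 and so have code 0, which on the detour only
    -- its start has.
    detour∩lifted : ∀ {v} → ¬ (v ∈ walk (identity N) (first ∷ detour) × v ∈ map liftVertex (walk start rest))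
    detour∩lifted (v∈ , v∈lifted) with ∈-map⁻ liftVertex v∈lifted
    detour∩lifted (here refl , _) | w , w∈ , eq =
      identity∉walk (subst (_∈ walk start rest) (liftVertex-injective (trans (sym eq) (sym (liftVertex-identity n)))) w∈)
    detour∩lifted (there v∈ , _) | w , w∈ , refl =
      ℕ.<-irrefl refl (∈-iterate-suc⇒≥ (subst (0 ∈_) (L.∷-injectiveʳ (proj₁ detour-run)) (∈-map⁺ code v∈)))

    walk-unique′ : Unique (walk (identity N) (first ∷ detour ++ lifted))
    walk-unique′ = subst Unique (sym walk-split)
      (Unique.++⁺ (numbered-unique (proj₁ detour-run)) (Unique.map⁺ liftVertex-injective walk-tail-unique) detour∩lifted)
      where
      walk-tail-unique : Unique (walk start rest)
      walk-tail-unique with walk-unique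
      ... | _ AllPairs.∷ u = u

    NewOr67 : Label N → Set
    NewOr67 l = (toℕ (proj₁ l) < 4) ⊎ (l ≡ (6F , 7F))

    detour-newOr67 : All NewOr67 (first ∷ detour)
    detour-newOr67 = inj₁ (s≤s (s≤s (s≤s z≤n))) All.∷
      All.++⁺ (All.map (inj₁ ∘ proj₂) up-new)
        (All.++⁺ (inj₁ (s≤s z≤n) All.∷ inj₁ (s≤s (s≤s z≤n)) All.∷ inj₁ (s≤s z≤n) All.∷ All.[])
          (All.++⁺ (All.map (inj₁ ∘ proj₂) down-new)
            (inj₂ refl All.∷ inj₁ (s≤s z≤n) All.∷ inj₁ (s≤s (s≤s z≤n)) All.∷ All.[])))

    first∉rest : ¬ (first ∈ rest)
    first∉rest with labels-unique
    ... | first∉ AllPairs.∷ _ = λ p → All.lookup first∉ p refl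

    detour∩lifted-labels : ∀ {l} → ¬ (l ∈ first ∷ detour × l ∈ lifted)
    detour∩lifted-labels (l∈ , l∈lifted) with ∈-map⁻ liftLabel l∈lifted
    ... | y , y∈ , refl with All.lookup detour-newOr67 l∈
    ...   | inj₁ (s≤s (s≤s (s≤s (s≤s ()))))
    ...   | inj₂ eq = first∉rest (subst (_∈ rest) (liftLabel-injective eq) y∈)

    labels-unique′ : Unique (first ∷ detour ++ lifted)
    labels-unique′ = Unique.++⁺ (numbered-unique numbered-detour) (Unique.map⁺ liftLabel-injective rest-unique) detour∩lifted-labels
      where
      rest-unique : Unique rest
      rest-unique with labels-unique
      ... | _ AllPairs.∷ u = u

    ordered′ : All Ordered (first ∷ detour ++ lifted)
    ordered′ = s≤s (s≤s (s≤s z≤n)) All.∷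
      All.++⁺ (All.++⁺ (All.map proj₁ up-new)
        (All.++⁺ (s≤s z≤n All.∷ s≤s (s≤s z≤n) All.∷ s≤s z≤n All.∷ All.[])
          (All.++⁺ (All.map proj₁ down-new)
            (s≤s (s≤s (s≤s (s≤s (s≤s (s≤s (s≤s z≤n)))))) All.∷ s≤s z≤n All.∷ s≤s (s≤s z≤n) All.∷ All.[]))))
        (All.map⁺ (All.map (s≤s ∘ s≤s ∘ s≤s ∘ s≤s) rest-ordered))
      where
      rest-ordered : All Ordered rest
      rest-ordered with ordered
      ... | _ All.∷ o = o

    module _ {l : Label N} where
      ∈-up′ : l ∈ up → l ∈ first ∷ detour ++ lifted
      ∈-up′ p = there (∈-++⁺ˡ (∈-++⁺ˡ p))
      ∈-middle : l ∈ middle → l ∈ first ∷ detour ++ lifted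
      ∈-middle p = there (∈-++⁺ˡ (∈-++⁺ʳ up (∈-++⁺ˡ p)))
      ∈-down′ : l ∈ down → l ∈ first ∷ detour ++ lifted
      ∈-down′ p = there (∈-++⁺ˡ (∈-++⁺ʳ up (∈-++⁺ʳ middle (∈-++⁺ˡ p))))
      ∈-closing : l ∈ closing → l ∈ first ∷ detour ++ lifted
      ∈-closing p = there (∈-++⁺ˡ (∈-++⁺ʳ up (∈-++⁺ʳ middle (∈-++⁺ʳ down p))))
      ∈-lifted : l ∈ lifted → l ∈ first ∷ detour ++ lifted
      ∈-lifted p = there (∈-++⁺ʳ detour p)

    covers′ : ∀ i j → i F.< j → (i , j) ∈ first ∷ detour ++ lifted
    covers′ 0F 1F _ = ∈-middle (here refl)
    covers′ 0F 2F _ = ∈-middle (there (there (here refl)))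
    covers′ 0F 3F _ = ∈-closing (there (here refl))
    covers′ 0F (fs (fs (fs (fs j)))) _ = ∈-up′ (proj₁ (∈-up j))
    covers′ 1F 2F _ = ∈-closing (there (there (here refl)))
    covers′ 1F 3F _ = ∈-middle (there (here refl))
    covers′ 1F (fs (fs (fs (fs j)))) _ = ∈-up′ (proj₂ (∈-up j))
    covers′ 1F 1F (s≤s ())
    covers′ 2F 1F (s≤s ())
    covers′ 2F 2F (s≤s (s≤s ()))
    covers′ 2F 3F _ = here refl
    covers′ 3F 1F (s≤s ())
    covers′ 3F 2F (s≤s (s≤s ()))
    covers′ 3F 3F (s≤s (s≤s (s≤s ())))
    covers′ 2F (fs (fs (fs (fs j)))) _ = ∈-down′ (proj₁ (∈-down j))
    covers′ 3F (fs (fs (fs (fs j)))) _ = ∈-down′ (proj₂ (∈-down j))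
    covers′ (fs (fs (fs (fs i)))) (fs (fs (fs (fs j)))) (s≤s (s≤s (s≤s (s≤s i<j)))) with covers i j i<j
    ... | here refl = ∈-closing (here refl)
    ... | there p   = ∈-lifted (∈-map⁺ liftLabel p)

    long′ : 2 ≤ length (detour ++ lifted)
    long′ = begin
      2                                                           ≤⟨ s≤s (s≤s z≤n) ⟩
      n + n                                                       ≡⟨ sym length-up ⟩
      length up                                                   ≤⟨ ℕ.m≤m+n _ _ ⟩
      length up + length (middle ++ (down ++ closing))            ≡⟨ sym (L.length-++ up) ⟩
      length detour                                               ≤⟨ ℕ.m≤m+n _ _ ⟩
      length detour + length lifted                               ≡⟨ sym (L.length-++ detour) ⟩
      length (detour ++ lifted)                                   ∎
      where open ℕ.≤-Reasoning

    extend : RainbowTour n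
    extend = record
      { rest = detour ++ lifted ; ordered = ordered′ ; labels-unique = labels-unique′ ; covers = covers′
      ; closed = closed′ ; walk-unique = walk-unique′ ; long = long′ }

tour₀ : RainbowTour 0
tour₀ = record
  { rest = rest₀
  ; ordered = from-yes ordered? ; labels-unique = from-yes labels-unique? ; covers = from-yes covers?
  ; closed = from-yes closed? ; walk-unique = from-yes walk-unique? ; long = s≤s (s≤s z≤n) }
  where
  rest₀ : List (Label 4)
  rest₀ = (0F , 1F) ∷ (0F , 2F) ∷ (1F , 3F) ∷ (0F , 3F) ∷ (1F , 2F) ∷ []
  open TourByComputation rest₀

tour₁ : RainbowTour 1
tour₁ = record
  { rest = rest₁
  ; ordered = from-yes ordered? ; labels-unique = from-yes labels-unique? ; covers = from-yes covers?
  ; closed = from-yes closed? ; walk-unique = from-yes walk-unique? ; long = s≤s (s≤s z≤n) }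
  where
  rest₁ : List (Label 5)
  rest₁ = (0F , 1F) ∷ (0F , 2F) ∷ (0F , 3F) ∷ (1F , 3F) ∷ (1F , 4F) ∷ (1F , 2F) ∷ (3F , 4F) ∷ (0F , 4F) ∷ (2F , 4F) ∷ []
  open TourByComputation rest₁

half-parity-periodic : ∀ k → ((4 + k) / 2) % 2 ≡ (k / 2) % 2
half-parity-periodic k = trans (cong (_% 2) (trans (/2-suc-suc (2 + k)) (cong suc (/2-suc-suc k)))) (%2-suc-suc (k / 2))

tour : ∀ m → ((4 + m) / 2) % 2 ≡ 0 → RainbowTour m
tour 0 _ = tour₀
tour 1 _ = tour₁
tour 2 ()
tour 3 ()
tour (suc (suc (suc (suc m)))) even = Extension.extend m (tour m (trans (sym (half-parity-periodic (4 + m))) even))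

rainbowCycle : ∀ n → 2 ≤ n → (n / 2) % 2 ≡ 0 → RainbowCycle n
rainbowCycle 1 (s≤s ()) _
rainbowCycle 2 _ ()
rainbowCycle 3 _ ()
rainbowCycle (suc (suc (suc (suc m)))) _ even = tour→cycle (tour m even)

theorem14 : ∀ (n : ℕ) → 2 ≤ n →
    ((n / 2) % 2 ≡ 1 → ¬ RainbowCycle n) × ((n / 2) % 2 ≡ 0 → RainbowCycle n)
theorem14 n 2≤n = noRainbowCycle n , rainbowCycle n 2≤n
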